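{- Let $c_1,c_2,c_3$ be complex constants with $c_2\neq 0$, and let $A(i,n)$, for integers $i\ge 0$, $n\ge 0$, be defined by \[ A(i,0)=\delta_{i,0}\quad (i\ge 0),\qquad A(0,n)=c_3\,A(1,n-1)\quad (n\ge 1), \] \[ A(i,n)=c_1\,A(i-1,n-1)+c_2\,A(i+1,n-1)\quad (i\ge 1,\ n\ge 1). \] Then for every integer $i\ge 0$, the generating function $d_i(t):=\sum_{n=0}^{\infty}A(i,n)t^n$ satisfies, as an identity of formal power series in $t$, \[ d_i(t)=\frac{2c_2}{2c_2-c_3+c_3\sqrt{1-4c_1c_2t^2}}\cdot\left(\frac{1-\sqrt{1-4c_1c_2t^2}}{2c_2t}\right)^{i}. \]
   Context: Here $\delta_{i,0}$ is $1$ if $i=0$ and $0$ otherwise. $\sqrt{1-4c_1c_2t^2}$ denotes the formal power series in $t$ with constant term $1$ whose square is $1-4c_1c_2t^2$; with this convention, $\left(1-\sqrt{1-4c_1c_2t^2}\right)/(2c_2t)$ is a formal power series in $t$ (with zero constant term), and the denominator $2c_2-c_3+c_3\sqrt{1-4c_1c_2t^2}$ has nonzero constant term $2c_2$, so the first factor is a formal power series. -}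

module Defs where

open import Level using (Level; _⊔_) renaming (suc to lsuc)
open import Data.Nat as ℕ using (ℕ; zero; suc)
open import Data.Product using (Σ; _,_)
open import Relation.Nullary using (¬_)
open import Algebra.Bundles using (CommutativeRing)

-- A field of characteristic zero (stand-in for ℂ, which the
-- standard library does not provide): a commutative ring in which
-- 1 ≠ 0, every nonzero element has a multiplicative inverse, and
-- no positive integer n·1 is zero.
-- the image of a natural number in a ring: n ↦ 1 + 1 + ... + 1
ofℕ : ∀ {c ℓ} (R : CommutativeRing c ℓ) → ℕ → CommutativeRing.Carrier R
ofℕ R zero    = CommutativeRing.0# R
ofℕ R (suc n) = CommutativeRing._+_ R (CommutativeRing.1# R) (ofℕ R n)

record Field₀ (c ℓ : Level) : Set (lsuc (c ⊔ ℓ)) where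
  field
    cring    : CommutativeRing c ℓ
  open CommutativeRing cring
  field
    1≉0      : ¬ (1# ≈ 0#)
    inverse  : ∀ x → ¬ (x ≈ 0#) → Σ Carrier (λ y → x * y ≈ 1#)
    char-0   : ∀ n → ¬ (ofℕ cring (suc n) ≈ 0#)

module FPS {c ℓ : Level} (R : CommutativeRing c ℓ) where
  open CommutativeRing R hiding (zero)

  Series : Set c
  Series = ℕ → Carrier

  _≋_ : Series → Series → Set ℓ
  f ≋ g = ∀ n → f n ≈ g n

  const : Carrier → Series
  const a zero    = a
  const a (suc n) = 0#

  one : Series
  one = const 1#

  X : Series
  X zero          = 0#
  X (suc zero)    = 1#
  X (suc (suc n)) = 0#

  _⊕_ : Series → Series → Series
  (f ⊕ g) n = f n + g n

  ⊝_ : Series → Series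
  (⊝ f) n = - (f n)

  _⊖_ : Series → Series → Series
  f ⊖ g = f ⊕ (⊝ g)

  _·_ : Carrier → Series → Series
  (a · f) n = a * f n

  conv : Series → Series → ℕ → ℕ → Carrier
  conv f g n zero    = f zero * g n
  conv f g n (suc k) = f (suc k) * g (n ℕ.∸ suc k) + conv f g n k

  _⋆_ : Series → Series → Series
  (f ⋆ g) n = conv f g n n

  _^ₛ_ : Series → ℕ → Series
  f ^ₛ zero  = one
  f ^ₛ suc i = f ⋆ (f ^ₛ i)

  two : Carrier
  two = 1# + 1#

  four : Carrier
  four = two * two

  A : Carrier → Carrier → Carrier → ℕ → ℕ → Carrier
  A c₁ c₂ c₃ zero    zero    = 1#
  A c₁ c₂ c₃ (suc i) zero    = 0#
  A c₁ c₂ c₃ zero    (suc n) = c₃ * A c₁ c₂ c₃ 1 n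
  A c₁ c₂ c₃ (suc i) (suc n) = c₁ * A c₁ c₂ c₃ i n + c₂ * A c₁ c₂ c₃ (suc (suc i)) n

  d : Carrier → Carrier → Carrier → ℕ → Series
  d c₁ c₂ c₃ i n = A c₁ c₂ c₃ i n

module Submission where

-- Write k = 2c₂ and u = tP.  The defining equation of P says
-- S = 1 - k u; substituting this into S² = 1 - 4c₁c₂t² and cancelling the
-- factor 2k (a field of characteristic 0) gives u = c₁t² + c₂u², i.e.
--     P = c₁ t + c₂ t P².                                      (P-equation)
-- Substituting S = 1 - k u into F·(k - c₃ + c₃S) = k and cancelling k gives
--     F = 1 + c₃ t F P.                                        (F-equation)
-- These two functional equations alone (over any commutative ring) force
-- the coefficient families D i = F Pⁱ to satisfy the recurrence defining
-- A(i,n) together with its initial values, and a solution of that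
-- recurrence is unique.  Hence d i = F Pⁱ.

open import Defs
open import Data.Nat using (ℕ)
open import Relation.Nullary using (¬_)
open import Algebra.Bundles using (CommutativeRing)
open import Data.Nat using (zero; suc; _∸_; _≤_)
open import Data.Nat.Properties using (≤-refl; ≤-trans; n≤1+n; n∸n≡0; +-∸-assoc)
open import Data.Product using (_,_)
open import Relation.Binary.Bundles using (Setoid)
open import Relation.Binary.PropositionalEquality using (cong)
import Relation.Binary.Reasoning.Setoid as SetoidReasoning
import Algebra.Properties.Group as GroupProperties
import Algebra.Properties.CommutativeSemigroup as CommutativeSemigroupProperties
import Algebra.Solver.Ring.NaturalCoefficients.Default as NaturalSolver

module SeriesAlgebra {c ℓ} (R : CommutativeRing c ℓ) where
  open CommutativeRing R hiding (zero)
  open FPS R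
  open SetoidReasoning setoid
  open CommutativeSemigroupProperties +-commutativeSemigroup
    using (interchange) renaming (x∙yz≈y∙xz to x+[y+z]≈y+[x+z])
  open CommutativeSemigroupProperties *-commutativeSemigroup
    using () renaming (x∙yz≈y∙xz to x*[y*z]≈y*[x*z])
  open NaturalSolver commutativeSemiring using (solve; _:=_; _:+_; _:*_)

  ≋-setoid : Setoid c ℓ
  ≋-setoid = record
    { Carrier       = Series
    ; _≈_           = _≋_
    ; isEquivalence = record
      { refl  = λ n → refl
      ; sym   = λ e n → sym (e n)
      ; trans = λ e e′ n → trans (e n) (e′ n)
      }
    }

  open Setoid ≋-setoid public using () renaming (refl to ≋-refl; sym to ≋-sym; trans to ≋-trans)

  ⊕-cong : ∀ {f f′ g g′} → f ≋ f′ → g ≋ g′ → (f ⊕ g) ≋ (f′ ⊕ g′)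
  ⊕-cong ef eg n = +-cong (ef n) (eg n)

  ·-congˡ : ∀ a {f g} → f ≋ g → (a · f) ≋ (a · g)
  ·-congˡ a e n = *-congˡ (e n)

  conv-cong : ∀ {f f′ g g′} → f ≋ f′ → g ≋ g′ → ∀ n k → conv f g n k ≈ conv f′ g′ n k
  conv-cong ef eg n zero    = *-cong (ef 0) (eg n)
  conv-cong ef eg n (suc k) = +-cong (*-cong (ef (suc k)) (eg _)) (conv-cong ef eg n k)

  ⋆-cong : ∀ {f f′ g g′} → f ≋ f′ → g ≋ g′ → (f ⋆ g) ≋ (f′ ⋆ g′)
  ⋆-cong ef eg n = conv-cong ef eg n n

  ⋆-congˡ : ∀ f {g g′} → g ≋ g′ → (f ⋆ g) ≋ (f ⋆ g′)
  ⋆-congˡ f = ⋆-cong ≋-refl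

  conv-distribʳ : ∀ f g h n k → conv (f ⊕ g) h n k ≈ conv f h n k + conv g h n k
  conv-distribʳ f g h n zero    = distribʳ _ _ _
  conv-distribʳ f g h n (suc k) =
    trans (+-cong (distribʳ _ _ _) (conv-distribʳ f g h n k)) (interchange _ _ _ _)

  conv-distribˡ : ∀ f g h n k → conv f (g ⊕ h) n k ≈ conv f g n k + conv f h n k
  conv-distribˡ f g h n zero    = distribˡ _ _ _
  conv-distribˡ f g h n (suc k) =
    trans (+-cong (distribˡ _ _ _) (conv-distribˡ f g h n k)) (interchange _ _ _ _)

  conv-scalarˡ : ∀ a f g n k → conv (a · f) g n k ≈ a * conv f g n k
  conv-scalarˡ a f g n zero    = *-assoc _ _ _
  conv-scalarˡ a f g n (suc k) =
    trans (+-cong (*-assoc _ _ _) (conv-scalarˡ a f g n k)) (sym (distribˡ _ _ _))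

  conv-scalarʳ : ∀ a f g n k → conv f (a · g) n k ≈ a * conv f g n k
  conv-scalarʳ a f g n zero    = x*[y*z]≈y*[x*z] _ _ _
  conv-scalarʳ a f g n (suc k) =
    trans (+-cong (x*[y*z]≈y*[x*z] _ _ _) (conv-scalarʳ a f g n k)) (sym (distribˡ _ _ _))

  ⋆-distribʳ : ∀ f g h → ((f ⊕ g) ⋆ h) ≋ ((f ⋆ h) ⊕ (g ⋆ h))
  ⋆-distribʳ f g h n = conv-distribʳ f g h n n

  ⋆-distribˡ : ∀ f g h → (f ⋆ (g ⊕ h)) ≋ ((f ⋆ g) ⊕ (f ⋆ h))
  ⋆-distribˡ f g h n = conv-distribˡ f g h n n

  ⋆-scalarˡ : ∀ a f g → ((a · f) ⋆ g) ≋ (a · (f ⋆ g))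
  ⋆-scalarˡ a f g n = conv-scalarˡ a f g n n

  ⋆-scalarʳ : ∀ a f g → (f ⋆ (a · g)) ≋ (a · (f ⋆ g))
  ⋆-scalarʳ a f g n = conv-scalarʳ a f g n n

  conv-const : ∀ a g n k → conv (const a) g n k ≈ a * g n
  conv-const a g n zero    = refl
  conv-const a g n (suc k) = trans (+-cong (zeroˡ _) (conv-const a g n k)) (+-identityˡ _)

  ⋆-const : ∀ a g → (const a ⋆ g) ≋ (a · g)
  ⋆-const a g n = conv-const a g n n

  ⋆-oneˡ : ∀ g → (one ⋆ g) ≋ g
  ⋆-oneˡ g n = trans (conv-const 1# g n n) (*-identityˡ _)

  const≋scaled-one : ∀ a → const a ≋ (a · one)
  const≋scaled-one a zero    = sym (*-identityʳ a)
  const≋scaled-one a (suc n) = sym (zeroʳ a)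

  conv-X : ∀ f m k → conv X f m (suc k) ≈ f (m ∸ 1)
  conv-X f m zero    = trans (+-cong (*-identityˡ _) (zeroˡ _)) (+-identityʳ _)
  conv-X f m (suc k) = trans (+-cong (zeroˡ _) (conv-X f m k)) (+-identityˡ _)

  X-shift : ∀ f n → (X ⋆ f) (suc n) ≈ f n
  X-shift f n = conv-X f (suc n) n

  X-zero : ∀ f → (X ⋆ f) 0 ≈ 0#
  X-zero f = zeroˡ _

  tail : Series → Series
  tail g n = g (suc n)

  conv-tail : ∀ f g n k → k ≤ n → conv f g (suc n) k ≈ conv f (tail g) n k
  conv-tail f g n zero    _   = refl
  conv-tail f g n (suc k) k<n =
    +-cong (*-congˡ (reflexive (cong g (+-∸-assoc 1 k<n))))
           (conv-tail f g n k (≤-trans (n≤1+n k) k<n))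

  ⋆-suc : ∀ f g n → (f ⋆ g) (suc n) ≈ f (suc n) * g 0 + (f ⋆ tail g) n
  ⋆-suc f g n = +-cong (*-congˡ (reflexive (cong g (n∸n≡0 n)))) (conv-tail f g n n ≤-refl)

  ⋆-comm : ∀ f g → (f ⋆ g) ≋ (g ⋆ f)
  ⋆-comm f g zero          = *-comm _ _
  ⋆-comm f g (suc zero)    = begin
    (f ⋆ g) 1              ≈⟨ ⋆-suc f g 0 ⟩
    f 1 * g 0 + f 0 * g 1  ≈⟨ swap-products (f 1) (g 0) (f 0) (g 1) ⟩
    g 1 * f 0 + g 0 * f 1  ≈⟨ ⋆-suc g f 0 ⟨
    (g ⋆ f) 1              ∎
    where
    swap-products : ∀ a b c d → a * b + c * d ≈ d * c + b * a
    swap-products = solve 4 (λ a b c d → a :* b :+ c :* d := d :* c :+ b :* a) refl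
  ⋆-comm f g (suc (suc m)) = begin
    (f ⋆ g) (2+ m)                                   ≈⟨ ⋆-suc f g (suc m) ⟩
    f (2+ m) * g 0 + (f ⋆ tail g) (suc m)            ≈⟨ +-congˡ (⋆-comm f (tail g) (suc m)) ⟩
    f (2+ m) * g 0 + (tail g ⋆ f) (suc m)            ≈⟨ +-congˡ (⋆-suc (tail g) f m) ⟩
    f (2+ m) * g 0 + (g (2+ m) * f 0 + (tail g ⋆ tail f) m)
      ≈⟨ +-congˡ (+-congˡ (⋆-comm (tail g) (tail f) m)) ⟩
    f (2+ m) * g 0 + (g (2+ m) * f 0 + (tail f ⋆ tail g) m)
      ≈⟨ x+[y+z]≈y+[x+z] (f (2+ m) * g 0) (g (2+ m) * f 0) ((tail f ⋆ tail g) m) ⟩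
    g (2+ m) * f 0 + (f (2+ m) * g 0 + (tail f ⋆ tail g) m)
      ≈⟨ +-congˡ (⋆-suc (tail f) g m) ⟨
    g (2+ m) * f 0 + (tail f ⋆ g) (suc m)            ≈⟨ +-congˡ (⋆-comm (tail f) g (suc m)) ⟩
    g (2+ m) * f 0 + (g ⋆ tail f) (suc m)            ≈⟨ ⋆-suc g f (suc m) ⟨
    (g ⋆ f) (2+ m)                                   ∎
    where
    2+ : ℕ → ℕ
    2+ m = suc (suc m)

  ⋆-oneʳ : ∀ g → (g ⋆ one) ≋ g
  ⋆-oneʳ g = ≋-trans (⋆-comm g one) (⋆-oneˡ g)

  tail-⋆ : ∀ g h → tail (g ⋆ h) ≋ ((h 0 · tail g) ⊕ (g ⋆ tail h))
  tail-⋆ g h m = trans (⋆-suc g h m) (+-congʳ (*-comm _ _))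

  ⋆-assoc : ∀ f g h → ((f ⋆ g) ⋆ h) ≋ (f ⋆ (g ⋆ h))
  ⋆-assoc f g h zero    = *-assoc _ _ _
  ⋆-assoc f g h (suc n) = begin
    ((f ⋆ g) ⋆ h) (suc n)                             ≈⟨ ⋆-suc (f ⋆ g) h n ⟩
    (f ⋆ g) (suc n) * h 0 + ((f ⋆ g) ⋆ tail h) n
      ≈⟨ +-cong (*-congʳ (⋆-suc f g n)) (⋆-assoc f g (tail h) n) ⟩
    (f (suc n) * g 0 + (f ⋆ tail g) n) * h 0 + (f ⋆ (g ⋆ tail h)) n
      ≈⟨ regroup (f (suc n)) (g 0) ((f ⋆ tail g) n) (h 0) ((f ⋆ (g ⋆ tail h)) n) ⟩
    f (suc n) * (g 0 * h 0) + (h 0 * (f ⋆ tail g) n + (f ⋆ (g ⋆ tail h)) n)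
      ≈⟨ +-congˡ tail-of-product ⟨
    f (suc n) * (g 0 * h 0) + (f ⋆ tail (g ⋆ h)) n    ≈⟨ ⋆-suc f (g ⋆ h) n ⟨
    (f ⋆ (g ⋆ h)) (suc n)                             ∎
    where
    regroup : ∀ a b x c y → (a * b + x) * c + y ≈ a * (b * c) + (c * x + y)
    regroup = solve 5 (λ a b x c y → (a :* b :+ x) :* c :+ y := a :* (b :* c) :+ (c :* x :+ y)) refl
    tail-of-product : (f ⋆ tail (g ⋆ h)) n ≈ h 0 * (f ⋆ tail g) n + (f ⋆ (g ⋆ tail h)) n
    tail-of-product = trans (⋆-congˡ f (tail-⋆ g h) n)
                            (trans (⋆-distribˡ f _ _ n) (+-congʳ (⋆-scalarʳ (h 0) f (tail g) n)))

  ⋆-swap : ∀ f g h → (f ⋆ (g ⋆ h)) ≋ (g ⋆ (f ⋆ h))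
  ⋆-swap f g h = ≋-trans (≋-sym (⋆-assoc f g h))
                         (≋-trans (⋆-cong (⋆-comm f g) ≋-refl) (⋆-assoc g f h))

  ⋆X-shift : ∀ f g n → (f ⋆ (X ⋆ g)) (suc n) ≈ (f ⋆ g) n
  ⋆X-shift f g n = trans (⋆-swap f X g (suc n)) (X-shift (f ⋆ g) n)

module Recurrence {c ℓ} (R : CommutativeRing c ℓ) (c₁ c₂ c₃ : CommutativeRing.Carrier R) where
  open CommutativeRing R hiding (zero)
  open FPS R
  open SeriesAlgebra R
  open SetoidReasoning ≋-setoid

  record Solves (D : ℕ → Series) : Set ℓ where
    field
      initial-zero : D 0 0 ≈ 1#
      initial-suc  : ∀ i → D (suc i) 0 ≈ 0#
      boundary     : ∀ n → D 0 (suc n) ≈ c₃ * D 1 n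
      interior     : ∀ i n → D (suc i) (suc n) ≈ c₁ * D i n + c₂ * D (suc (suc i)) n

  d-unique : ∀ {D} → Solves D → ∀ i → d c₁ c₂ c₃ i ≋ D i
  d-unique {D} sol i n = A≈D n i
    where
    open Solves sol
    A≈D : ∀ n i → A c₁ c₂ c₃ i n ≈ D i n
    A≈D zero    zero    = sym initial-zero
    A≈D zero    (suc i) = sym (initial-suc i)
    A≈D (suc n) zero    = trans (*-congˡ (A≈D n 1)) (sym (boundary n))
    A≈D (suc n) (suc i) =
      trans (+-cong (*-congˡ (A≈D n i)) (*-congˡ (A≈D n (suc (suc i))))) (sym (interior i n))

  module _ {F P : Series}
           (P-equation : P ≋ ((c₁ · X) ⊕ (c₂ · (X ⋆ (P ⋆ P)))))
           (F-equation : F ≋ (one ⊕ (c₃ · (X ⋆ (F ⋆ P)))))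
           where

    P-constant : P 0 ≈ 0#
    P-constant = trans (P-equation 0)
      (trans (+-cong (zeroʳ c₁) (trans (*-congˡ (X-zero (P ⋆ P))) (zeroʳ c₂))) (+-identityʳ 0#))

    F-constant : F 0 ≈ 1#
    F-constant = trans (F-equation 0)
      (trans (+-congˡ (trans (*-congˡ (X-zero (F ⋆ P))) (zeroʳ c₃))) (+-identityʳ 1#))

    power-step : ∀ i → (P ^ₛ suc i) ≋ ((c₁ · (X ⋆ (P ^ₛ i))) ⊕ (c₂ · (X ⋆ (P ^ₛ suc (suc i)))))
    power-step i = begin
      (P ⋆ Q)                                                 ≈⟨ ⋆-cong P-equation ≋-refl ⟩
      (((c₁ · X) ⊕ (c₂ · (X ⋆ (P ⋆ P)))) ⋆ Q)                 ≈⟨ ⋆-distribʳ _ _ Q ⟩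
      (((c₁ · X) ⋆ Q) ⊕ ((c₂ · (X ⋆ (P ⋆ P))) ⋆ Q))           ≈⟨ ⊕-cong (⋆-scalarˡ c₁ X Q) (⋆-scalarˡ c₂ _ Q) ⟩
      ((c₁ · (X ⋆ Q)) ⊕ (c₂ · ((X ⋆ (P ⋆ P)) ⋆ Q)))           ≈⟨ ⊕-cong ≋-refl (·-congˡ c₂ reassociate) ⟩
      ((c₁ · (X ⋆ Q)) ⊕ (c₂ · (X ⋆ (P ⋆ (P ⋆ Q)))))           ∎
      where
      Q : Series
      Q = P ^ₛ i
      reassociate : ((X ⋆ (P ⋆ P)) ⋆ Q) ≋ (X ⋆ (P ⋆ (P ⋆ Q)))
      reassociate = ≋-trans (⋆-assoc X (P ⋆ P) Q) (⋆-congˡ X (⋆-assoc P P Q))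

    powers-solve : Solves (λ i → F ⋆ (P ^ₛ i))
    powers-solve = record
      { initial-zero = trans (*-identityʳ _) F-constant
      ; initial-suc  = λ i → trans (*-congˡ (trans (*-congʳ P-constant) (zeroˡ _))) (zeroʳ _)
      ; boundary     = boundary
      ; interior     = interior
      }
      where
      boundary : ∀ n → (F ⋆ one) (suc n) ≈ c₃ * (F ⋆ (P ⋆ one)) n
      boundary n =
        trans (⋆-oneʳ F (suc n))
        (trans (F-equation (suc n))
        (trans (+-identityˡ _)
        (*-congˡ (trans (X-shift (F ⋆ P) n) (⋆-congˡ F (≋-sym (⋆-oneʳ P)) n)))))

      interior : ∀ i n → (F ⋆ (P ^ₛ suc i)) (suc n)
                           ≈ c₁ * (F ⋆ (P ^ₛ i)) n + c₂ * (F ⋆ (P ^ₛ suc (suc i))) n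
      interior i n =
        trans (⋆-congˡ F (power-step i) (suc n))
        (trans (⋆-distribˡ F _ _ (suc n))
        (+-cong (trans (⋆-scalarʳ c₁ F _ (suc n)) (*-congˡ (⋆X-shift F _ n)))
                (trans (⋆-scalarʳ c₂ F _ (suc n)) (*-congˡ (⋆X-shift F _ n)))))

module FieldFacts {c ℓ} (K : Field₀ c ℓ) where
  open Field₀ K
  open CommutativeRing cring hiding (zero)
  open FPS cring using (two)

  *-cancelˡ : ∀ {a x y} → ¬ (a ≈ 0#) → a * x ≈ a * y → x ≈ y
  *-cancelˡ {a} {x} {y} a≉0 ax≈ay with inverse a a≉0
  ... | b , ab≈1 = trans (sym (undo x)) (trans (*-congˡ ax≈ay) (undo y))
    where
    undo : ∀ z → b * (a * z) ≈ z
    undo z = trans (sym (*-assoc b a z))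
                   (trans (*-congʳ (trans (*-comm b a) ab≈1)) (*-identityˡ z))

  *-nonzero : ∀ {a b} → ¬ (a ≈ 0#) → ¬ (b ≈ 0#) → ¬ (a * b ≈ 0#)
  *-nonzero a≉0 b≉0 ab≈0 = b≉0 (*-cancelˡ a≉0 (trans ab≈0 (sym (zeroʳ _))))

  two≉0 : ¬ (two ≈ 0#)
  two≉0 two≈0 = char-0 1 (trans (+-congˡ (+-identityʳ 1#)) two≈0)

module FunctionalEquations {c ℓ} (K : Field₀ c ℓ) where
  open Field₀ K using (cring)
  open CommutativeRing cring hiding (zero)
  open FPS cring
  open SeriesAlgebra cring
  open FieldFacts K
  open SetoidReasoning setoid
  open GroupProperties +-group using (∙-cancelˡ; //-rightDividesˡ)
  open NaturalSolver commutativeSemiring using (solve; _:=_; _:+_; _:*_; con)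

  subtracted : ∀ {a b s} → a ≈ b - s → a + s ≈ b
  subtracted {s = s} a≈b-s = trans (+-congʳ a≈b-s) (//-rightDividesˡ s _)

  module _ (c₁ c₂ : Carrier) (c₂≉0 : ¬ (c₂ ≈ 0#)) (S P : Series)
           (P-def : (((two * c₂) · X) ⋆ P) ≋ (one ⊖ S)) where

    k : Carrier
    k = two * c₂

    k≉0 : ¬ (k ≈ 0#)
    k≉0 = *-nonzero two≉0 c₂≉0

    -- u = t P, so that the definition of P reads S = 1 - k u.
    u : Series
    u = X ⋆ P

    S+ku≈1 : (S ⊕ (k · u)) ≋ one
    S+ku≈1 n = begin
      S n + k * u n          ≈⟨ +-comm _ _ ⟩
      k * u n + S n          ≈⟨ subtracted (trans (sym (⋆-scalarˡ k X P n)) (P-def n)) ⟩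
      one n                  ∎

    absorb : ∀ h n → (S ⋆ h) n + k * (u ⋆ h) n ≈ h n
    absorb h n = begin
      (S ⋆ h) n + k * (u ⋆ h) n     ≈⟨ +-congˡ (⋆-scalarˡ k u h n) ⟨
      (S ⋆ h) n + ((k · u) ⋆ h) n   ≈⟨ ⋆-distribʳ S (k · u) h n ⟨
      ((S ⊕ (k · u)) ⋆ h) n         ≈⟨ ⋆-cong S+ku≈1 ≋-refl n ⟩
      (one ⋆ h) n                   ≈⟨ ⋆-oneˡ h n ⟩
      h n                           ∎

    module _ (S-square : (S ⋆ S) ≋ (one ⊖ ((four * c₁ * c₂) · (X ⋆ X)))) where

      -- Squaring S = 1 - k u and comparing with S² = 1 - 4c₁c₂t²
      -- gives 2k u - k² u² = 4c₁c₂t², i.e. u = c₁t² + c₂u².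
      u-quadratic : ∀ n → c₁ * (X ⋆ X) n + c₂ * (u ⋆ u) n ≈ u n
      u-quadratic n = *-cancelˡ (*-nonzero two≉0 k≉0) (begin
        (two * k) * (c₁ * x + c₂ * w)   ≈⟨ scale c₁ c₂ x w ⟩
        m * x + k * (k * w)             ≈⟨ +-congʳ linear ⟨
        (k * a + k * u n) + k * (k * w) ≈⟨ regroup k a (u n) w ⟩
        k * (a + k * w) + k * u n       ≈⟨ +-congʳ (*-congˡ (absorb u n)) ⟩
        k * u n + k * u n               ≈⟨ double k (u n) ⟩
        (two * k) * u n                 ∎)
        where
        m x w a : Carrier
        m = four * c₁ * c₂
        x = (X ⋆ X) n
        w = (u ⋆ u) n
        a = (S ⋆ u) n
        scale : ∀ a b x w → (two * (two * b)) * (a * x + b * w)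
                            ≈ (four * a * b) * x + (two * b) * ((two * b) * w)
        scale = solve 4 (λ c₁ c₂ x w →
          (con 2 :* (con 2 :* c₂)) :* (c₁ :* x :+ c₂ :* w)
            := (con 2 :* con 2 :* c₁ :* c₂) :* x :+ (con 2 :* c₂) :* ((con 2 :* c₂) :* w)) refl
        regroup : ∀ k a v w → (k * a + k * v) + k * (k * w) ≈ k * (a + k * w) + k * v
        regroup = solve 4 (λ k a v w → (k :* a :+ k :* v) :+ k :* (k :* w)
                                         := k :* (a :+ k :* w) :+ k :* v) refl
        double : ∀ k v → k * v + k * v ≈ (two * k) * v
        double = solve 2 (λ k v → k :* v :+ k :* v := (con 2 :* k) :* v) refl
        -- the cross terms of S² = (1 - k u)²: k (S u) + k u = 4c₁c₂t²
        linear : k * a + k * u n ≈ m * x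
        linear = ∙-cancelˡ ((S ⋆ S) n) _ _ (begin
          (S ⋆ S) n + (k * a + k * u n)            ≈⟨ +-assoc _ _ _ ⟨
          ((S ⋆ S) n + k * a) + k * u n            ≈⟨ +-congʳ (+-congˡ (*-congˡ (⋆-comm S u n))) ⟩
          ((S ⋆ S) n + k * (u ⋆ S) n) + k * u n    ≈⟨ +-congʳ (absorb S n) ⟩
          S n + k * u n                            ≈⟨ S+ku≈1 n ⟩
          one n                                    ≈⟨ subtracted (S-square n) ⟨
          (S ⋆ S) n + m * x                        ∎)

      -- Dividing u = c₁t² + c₂u² by t.
      P-equation : P ≋ ((c₁ · X) ⊕ (c₂ · (X ⋆ (P ⋆ P))))
      P-equation n = begin
        P n                                                ≈⟨ X-shift P n ⟨
        u (suc n)                                          ≈⟨ u-quadratic (suc n) ⟨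
        c₁ * (X ⋆ X) (suc n) + c₂ * (u ⋆ u) (suc n)        ≈⟨ +-cong (*-congˡ (X-shift X n)) (*-congˡ u²-shift) ⟩
        c₁ * X n + c₂ * (X ⋆ (P ⋆ P)) n                    ∎
        where
        u²-shift : (u ⋆ u) (suc n) ≈ (X ⋆ (P ⋆ P)) n
        u²-shift = trans (⋆-assoc X P u (suc n))
                  (trans (X-shift (P ⋆ u) n) (⋆-swap P X P n))

    module _ (c₃ : Carrier) (F : Series)
             (F-def : (F ⋆ ((const (two * c₂ - c₃)) ⊕ (c₃ · S))) ≋ const (two * c₂)) where

      -- The denominator of F, rewritten with S = 1 - k u: G + k c₃ u = k.
      G : Series
      G = (const (k - c₃)) ⊕ (c₃ · S)

      G-in-u : (G ⊕ ((k * c₃) · u)) ≋ const k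
      G-in-u n = begin
        (const (k - c₃) n + c₃ * S n) + (k * c₃) * u n    ≈⟨ regroup (const (k - c₃) n) c₃ (S n) k (u n) ⟩
        const (k - c₃) n + c₃ * (S n + k * u n)          ≈⟨ +-congˡ (*-congˡ (S+ku≈1 n)) ⟩
        const (k - c₃) n + c₃ * one n                    ≈⟨ constant-term n ⟩
        const k n                                        ∎
        where
        regroup : ∀ p c s k v → (p + c * s) + (k * c) * v ≈ p + c * (s + k * v)
        regroup = solve 5 (λ p c s k v → (p :+ c :* s) :+ (k :* c) :* v
                                           := p :+ c :* (s :+ k :* v)) refl
        constant-term : ∀ n → const (k - c₃) n + c₃ * one n ≈ const k n
        constant-term zero    = trans (+-congˡ (*-identityʳ c₃)) (//-rightDividesˡ c₃ k)
        constant-term (suc n) = trans (+-identityˡ _) (zeroʳ c₃)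

      -- Multiplying G + k c₃ u = k by F and cancelling k.
      F-equation : F ≋ (one ⊕ (c₃ · (X ⋆ (F ⋆ P))))
      F-equation n = sym (*-cancelˡ k≉0 (begin
        k * (one n + c₃ * (X ⋆ (F ⋆ P)) n)           ≈⟨ distribute k (one n) c₃ _ ⟩
        k * one n + (k * c₃) * (X ⋆ (F ⋆ P)) n       ≈⟨ +-cong (trans (F-def n) (const≋scaled-one k n))
                                                              (*-congˡ (⋆-swap F X P n)) ⟨
        (F ⋆ G) n + (k * c₃) * (F ⋆ u) n             ≈⟨ +-congˡ (⋆-scalarʳ (k * c₃) F u n) ⟨
        (F ⋆ G) n + (F ⋆ ((k * c₃) · u)) n           ≈⟨ ⋆-distribˡ F G _ n ⟨
        (F ⋆ (G ⊕ ((k * c₃) · u))) n                 ≈⟨ ⋆-congˡ F G-in-u n ⟩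
        (F ⋆ const k) n                              ≈⟨ trans (⋆-comm F (const k) n) (⋆-const k F n) ⟩
        k * F n                                      ∎))
        where
        distribute : ∀ k o c y → k * (o + c * y) ≈ k * o + (k * c) * y
        distribute = solve 4 (λ k o c y → k :* (o :+ c :* y) := k :* o :+ (k :* c) :* y) refl

-- The generating function of A(·,i) is F Pⁱ.
mainTheorem1 : ∀ {c ℓ} (K : Field₀ c ℓ) →
    let open Field₀ K using (cring) in
    let open CommutativeRing cring in
    let open FPS cring in
    (c₁ c₂ c₃ : Carrier) → ¬ (c₂ ≈ 0#) →
    (S : Series) → S 0 ≈ 1# → (S ⋆ S) ≋ (one ⊖ ((four * c₁ * c₂) · (X ⋆ X))) →
    (F : Series) → (F ⋆ ((const (two * c₂ - c₃)) ⊕ (c₃ · S))) ≋ const (two * c₂) →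
    (P : Series) → (((two * c₂) · X) ⋆ P) ≋ (one ⊖ S) →
    (i : ℕ) → d c₁ c₂ c₃ i ≋ (F ⋆ (P ^ₛ i))
mainTheorem1 K c₁ c₂ c₃ c₂≉0 S _ S-square F F-def P P-def =
  d-unique (powers-solve (P-equation c₁ c₂ c₂≉0 S P P-def S-square)
                         (F-equation c₁ c₂ c₂≉0 S P P-def c₃ F F-def))
  where
  open Recurrence (Field₀.cring K) c₁ c₂ c₃ using (d-unique; powers-solve)
  open FunctionalEquations K using (P-equation; F-equation)
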